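{- Let $\mathcal N$ be a phylogenetic network on $X$, let $A\subseteq X$, and let $v$ be a tree vertex of $\mathcal N$ that is a descendant of ${\rm lsa}(A)$. If $A$ contains every leaf of $\mathcal N$ that is a descendant of $v$, then every descendant vertex of $v$ in $\mathcal N$ is a vertex of $\mathcal N_A$.
   Context: All paths are directed. A (binary) phylogenetic network $\mathcal N$ on a non-empty finite set $X$ is a rooted acyclic directed graph with no parallel arcs such that: the unique root has in-degree 0 and out-degree 2; the set of vertices of out-degree 0 is $X$ (the leaves), each of in-degree 1; every other vertex has either in-degree 1 and out-degree 2 (tree vertex) or in-degree 2 and out-degree 1 (reticulation). If $|X|=1$, $\mathcal N$ may also be the single vertex of $X$. $v$ is a descendant of $u$ if there is a path from $u$ to $v$ (every vertex is a descendant of itself). A stable ancestor of $X'\subseteq X$ is a vertex $u$ such that for every $x\in X'$ every path from the root to $x$ traverses $u$; ${\rm lsa}(X')$ is the unique stable ancestor of $X'$ with no other stable ancestor of $X'$ as a descendant. The path graph of $\mathcal N$ on $A$ is the subgraph consisting of all vertices and arcs on paths from ${\rm lsa}(A)$ to leaves in $A$. The full simplification of a directed graph is obtained by repeatedly suppressing vertices of in-degree one and out-degree one and deleting exactly one arc of any pair of parallel arcs until neither applies; $\mathcal N_A$ (the network exhibited by $\mathcal N$ on $A$) is the full simplification of the path graph, so its vertices form a subset of the vertices of $\mathcal N$. -}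

module Defs where

open import Data.Nat using (ℕ)
open import Data.Fin using (Fin; _≟_)
open import Data.Fin.Subset using (Subset; _∈_; _-_)
open import Data.Product using (Σ; _×_; _,_; proj₁; proj₂)
open import Data.Sum using (_⊎_)
open import Data.Empty using (⊥)
open import Data.List using (List; _∷_; length; filter)
open import Data.List.Relation.Unary.Unique.Propositional using (Unique)
open import Data.List.Relation.Binary.Permutation.Propositional using (_↭_)
import Data.List.Membership.Propositional as LM
open import Relation.Binary.PropositionalEquality using (_≡_)

Arc : ℕ → Set
Arc n = Fin n × Fin n

indeg : ∀ {n} → List (Arc n) → Fin n → ℕ
indeg as w = length (filter (λ a → proj₂ a ≟ w) as)

outdeg : ∀ {n} → List (Arc n) → Fin n → ℕ
outdeg as w = length (filter (λ a → proj₁ a ≟ w) as)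

data Path {n} (as : List (Arc n)) : Fin n → Fin n → Set where
  here : ∀ {u} → Path as u u
  step : ∀ {u w v} → (u , w) LM.∈ as → Path as w v → Path as u v

data _∈P_ {n} {as : List (Arc n)} (x : Fin n) : ∀ {u v} → Path as u v → Set where
  start : ∀ {v} (p : Path as x v) → x ∈P p
  later : ∀ {u w v} (e : (u , w) LM.∈ as) (p : Path as w v) → x ∈P p → x ∈P step e p

record Network (n : ℕ) : Set where
  field
    root    : Fin n
    arcs    : List (Arc n)
    simple  : Unique arcs
    acyclic : ∀ {u v} → (u , v) LM.∈ arcs → Path arcs v u → ⊥
    rootDeg : indeg arcs root ≡ 0 × (outdeg arcs root ≡ 2 ⊎ (∀ v → v ≡ root))
    -- every other vertex is a leaf, a tree vertex, or a reticulation
    vtxDeg  : ∀ v → v ≡ root ⊎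
                ((indeg arcs v ≡ 1 × outdeg arcs v ≡ 0)
                 ⊎ (indeg arcs v ≡ 1 × outdeg arcs v ≡ 2)
                 ⊎ (indeg arcs v ≡ 2 × outdeg arcs v ≡ 1))

module _ {n : ℕ} (N : Network n) where
  open Network N

  IsLeaf : Fin n → Set
  IsLeaf v = outdeg arcs v ≡ 0

  IsTreeVertex : Fin n → Set
  IsTreeVertex v = indeg arcs v ≡ 1 × outdeg arcs v ≡ 2

  -- v is a descendant of u
  Desc : Fin n → Fin n → Set
  Desc u v = Path arcs u v

  LeafSet : Subset n → Set
  LeafSet A = ∀ x → x ∈ A → IsLeaf x

  StableAncestor : Subset n → Fin n → Set
  StableAncestor A u = ∀ x → x ∈ A → (p : Path arcs root x) → u ∈P p

  IsLSA : Subset n → Fin n → Set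
  IsLSA A u = StableAncestor A u × (∀ w → StableAncestor A w → Desc u w → w ≡ u)

-- Directed multigraphs on (a subset of) Fin n, arcs as a multiset (list)

record MGraph (n : ℕ) : Set where
  constructor mgraph
  field
    verts : Subset n
    arcs  : List (Arc n)

module _ {n : ℕ} (N : Network n) where
  private module N = Network N

  -- P is the path graph of N on A, where l = lsa(A): all vertices and arcs
  -- lying on paths from l to leaves in A (each arc once)
  IsPathGraph : Subset n → Fin n → MGraph n → Set
  IsPathGraph A l P =
      (∀ x → x ∈ MGraph.verts P →
           Σ (Fin n) λ a → a ∈ A × Path N.arcs l x × Path N.arcs x a)
    × (∀ x (a : Fin n) → a ∈ A → Path N.arcs l x → Path N.arcs x a → x ∈ MGraph.verts P)
    × Unique (MGraph.arcs P)
    × (∀ x y → (x , y) LM.∈ MGraph.arcs P →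
           (x , y) LM.∈ N.arcs × Σ (Fin n) λ a → a ∈ A × Path N.arcs l x × Path N.arcs y a)
    × (∀ x y (a : Fin n) → (x , y) LM.∈ N.arcs → a ∈ A →
           Path N.arcs l x → Path N.arcs y a → (x , y) LM.∈ MGraph.arcs P)

data SimpStep {n} : MGraph n → MGraph n → Set where
  suppress : ∀ {V as rest} (u w z : Fin n) → w ∈ V →
             indeg as w ≡ 1 → outdeg as w ≡ 1 →
             as ↭ ((u , w) ∷ (w , z) ∷ rest) →
             SimpStep (mgraph V as) (mgraph (V - w) ((u , z) ∷ rest))
  unpar    : ∀ {V as rest} (e : Arc n) →
             as ↭ (e ∷ e ∷ rest) →
             SimpStep (mgraph V as) (mgraph V (e ∷ rest))

data Steps {n} : MGraph n → MGraph n → Set where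
  done : ∀ {G} → Steps G G
  more : ∀ {G H K} → SimpStep G H → Steps H K → Steps G K

FullSimplification : ∀ {n} → MGraph n → MGraph n → Set
FullSimplification H G = Steps H G × (∀ G' → SimpStep G G' → ⊥)

-- Simplification never suppresses a descendant of v, because the following stays
-- true after every step: each descendant w of v is a vertex, its out-arcs are
-- exactly those of N, and if w is a reticulation then, for each parent p of w
-- below v, some in-arc of w comes from a vertex other than p.  The arc from p
-- itself survives as an out-arc of a descendant, so w keeps in-degree ≥ 2 (if a
-- reticulation) or out-degree ≠ 1 (otherwise).  The invariant holds in the path
-- graph since every descendant of v reaches a leaf in A, and every parent q of a
-- reticulation below v is a descendant of lsa(A): a root path through q and w
-- down to such a leaf must pass through lsa(A), and it cannot do so below w.
module Submission where

open import Defs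
open import Data.Nat using (zero; suc)
open import Data.Nat.Properties using (0≢1+n; 1+n≢n)
open import Data.Fin using (Fin; _≟_)
open import Data.Fin.Induction using (spo-wellFounded; spo-noetherian)
open import Data.Fin.Subset using (Subset; _∈_; _-_)
open import Data.Fin.Subset.Properties using (x∈p∧x≢y⇒x∈p-y)
open import Data.Product using (∃; ∃₂; _×_; _,_; proj₁; proj₂)
open import Data.Sum using (_⊎_; inj₁; inj₂)
open import Data.Empty using (⊥; ⊥-elim)
open import Data.List using (List; []; _∷_; length; filter)
open import Data.List.Relation.Unary.Any using (here; there)
open import Data.List.Relation.Unary.All using ([]; _∷_)
open import Data.List.Relation.Unary.AllPairs using (_∷_)
open import Data.List.Relation.Unary.Unique.Propositional using (Unique)
open import Data.List.Relation.Unary.Unique.Propositional.Properties using (filter⁺)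
open import Data.List.Relation.Binary.Subset.Propositional using (_⊆_)
open import Data.List.Relation.Binary.Permutation.Propositional using (_↭_; ↭-sym)
open import Data.List.Relation.Binary.Permutation.Propositional.Properties using (∈-resp-↭)
open import Data.List.Membership.Propositional using () renaming (_∈_ to _∈ₗ_; _∉_ to _∉ₗ_)
open import Data.List.Membership.Propositional.Properties using (∈-filter⁺; ∈-filter⁻)
open import Function using (flip)
open import Induction.WellFounded using (Acc; acc)
open import Level using (0ℓ)
open import Relation.Binary using (Rel; IsStrictPartialOrder)
open import Relation.Binary.PropositionalEquality
  using (_≡_; _≢_; refl; sym; trans; cong; isEquivalence; resp₂)
open import Relation.Nullary using (¬_; Dec; yes; no)

module _ {a} {A : Set a} where

  length≡0⇒∉ : ∀ {x} {xs : List A} → length xs ≡ 0 → x ∉ₗ xs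
  length≡0⇒∉ {xs = []} _ ()

  length≡1⇒∈-unique : ∀ {x y} {xs : List A} → length xs ≡ 1 → x ∈ₗ xs → y ∈ₗ xs → x ≡ y
  length≡1⇒∈-unique {xs = _ ∷ []} _ (here refl) (here refl) = refl

  length≡suc⇒∃∈ : ∀ {k} {xs : List A} → length xs ≡ suc k → ∃ λ x → x ∈ₗ xs
  length≡suc⇒∃∈ {xs = x ∷ _} _ = x , here refl

  length≡2⇒∃₂∈ : ∀ {xs : List A} → Unique xs → length xs ≡ 2 →
                 ∃₂ λ x y → x ≢ y × x ∈ₗ xs × y ∈ₗ xs
  length≡2⇒∃₂∈ {xs = x ∷ y ∷ []} ((x≢y ∷ []) ∷ _) _ = x , y , x≢y , here refl , there (here refl)

module _ {n} {as : List (Arc n)} {w : Fin n} where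
  private
    from? : (e : Arc n) → Dec (proj₁ e ≡ w)
    from? e = proj₁ e ≟ w

    into? : (e : Arc n) → Dec (proj₂ e ≡ w)
    into? e = proj₂ e ≟ w

  outdeg≡0⇒∉ : outdeg as w ≡ 0 → ∀ {c} → (w , c) ∉ₗ as
  outdeg≡0⇒∉ o e = length≡0⇒∉ o (∈-filter⁺ from? e refl)

  indeg≡0⇒∉ : indeg as w ≡ 0 → ∀ {u} → (u , w) ∉ₗ as
  indeg≡0⇒∉ i e = length≡0⇒∉ i (∈-filter⁺ into? e refl)

  outdeg≡1⇒≡ : outdeg as w ≡ 1 → ∀ {c₁ c₂} → (w , c₁) ∈ₗ as → (w , c₂) ∈ₗ as → c₁ ≡ c₂
  outdeg≡1⇒≡ o e₁ e₂ =
    cong proj₂ (length≡1⇒∈-unique o (∈-filter⁺ from? e₁ refl) (∈-filter⁺ from? e₂ refl))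

  indeg≡1⇒≡ : indeg as w ≡ 1 → ∀ {u₁ u₂} → (u₁ , w) ∈ₗ as → (u₂ , w) ∈ₗ as → u₁ ≡ u₂
  indeg≡1⇒≡ i e₁ e₂ =
    cong proj₁ (length≡1⇒∈-unique i (∈-filter⁺ into? e₁ refl) (∈-filter⁺ into? e₂ refl))

  outdeg≡suc⇒∃ : ∀ {k} → outdeg as w ≡ suc k → ∃ λ c → (w , c) ∈ₗ as
  outdeg≡suc⇒∃ o with length≡suc⇒∃∈ {xs = filter from? as} o
  ... | (_ , c) , e with ∈-filter⁻ from? e
  ...   | e′ , refl = c , e′

  indeg≡suc⇒∃ : ∀ {k} → indeg as w ≡ suc k → ∃ λ u → (u , w) ∈ₗ as
  indeg≡suc⇒∃ i with length≡suc⇒∃∈ {xs = filter into? as} i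
  ... | (u , _) , e with ∈-filter⁻ into? e
  ...   | e′ , refl = u , e′

  outdeg≡2⇒∃₂ : Unique as → outdeg as w ≡ 2 →
                ∃₂ λ c₁ c₂ → c₁ ≢ c₂ × (w , c₁) ∈ₗ as × (w , c₂) ∈ₗ as
  outdeg≡2⇒∃₂ u o with length≡2⇒∃₂∈ (filter⁺ from? u) o
  ... | (_ , c₁) , (_ , c₂) , ≢ , e₁ , e₂ with ∈-filter⁻ from? e₁ | ∈-filter⁻ from? e₂
  ...   | e₁′ , refl | e₂′ , refl = c₁ , c₂ , (λ { refl → ≢ refl }) , e₁′ , e₂′

  indeg≡2⇒∃₂ : Unique as → indeg as w ≡ 2 →
               ∃₂ λ u₁ u₂ → u₁ ≢ u₂ × (u₁ , w) ∈ₗ as × (u₂ , w) ∈ₗ as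
  indeg≡2⇒∃₂ u i with length≡2⇒∃₂∈ (filter⁺ into? u) i
  ... | (u₁ , _) , (u₂ , _) , ≢ , e₁ , e₂ with ∈-filter⁻ into? e₁ | ∈-filter⁻ into? e₂
  ...   | e₁′ , refl | e₂′ , refl = u₁ , u₂ , (λ { refl → ≢ refl }) , e₁′ , e₂′

  indeg≡2⇒other-parent : Unique as → indeg as w ≡ 2 → ∀ p → ∃ λ q → q ≢ p × (q , w) ∈ₗ as
  indeg≡2⇒other-parent u i p with indeg≡2⇒∃₂ u i
  ... | q₁ , q₂ , q₁≢q₂ , e₁ , e₂ with q₁ ≟ p
  ...   | yes refl = q₂ , (λ q₂≡q₁ → q₁≢q₂ (sym q₂≡q₁)) , e₂
  ...   | no q₁≢p  = q₁ , q₁≢p , e₁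

module _ {n} {as : List (Arc n)} where

  infixr 5 _++ᵖ_
  _++ᵖ_ : ∀ {x y z} → Path as x y → Path as y z → Path as x z
  here     ++ᵖ q = q
  step e p ++ᵖ q = step e (p ++ᵖ q)

  unsnoc : ∀ {x y} → Path as x y → x ≡ y ⊎ ∃ λ p → Path as x p × (p , y) ∈ₗ as
  unsnoc here = inj₁ refl
  unsnoc (step e p) with unsnoc p
  ... | inj₁ refl          = inj₂ (_ , here , e)
  ... | inj₂ (p′ , q , e′) = inj₂ (p′ , step e q , e′)

  ∈P⇒prefix : ∀ {x u t} {p : Path as u t} → x ∈P p → Path as u x
  ∈P⇒prefix (start _)     = here
  ∈P⇒prefix (later e _ m) = step e (∈P⇒prefix m)

  ∈P-++-step⁻ : ∀ {x u m y t} (p : Path as u m) (e : (m , y) ∈ₗ as) (q : Path as y t) →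
                x ∈P (p ++ᵖ step e q) → Path as x m ⊎ x ∈P q
  ∈P-++-step⁻ here       e q (start _)     = inj₁ here
  ∈P-++-step⁻ here       e q (later _ _ m) = inj₂ m
  ∈P-++-step⁻ (step f p) e q (start _)     = inj₁ (step f p)
  ∈P-++-step⁻ (step f p) e q (later _ _ m) = ∈P-++-step⁻ p e q m

module _ {n} (N : Network n) where
  open Network N

  _⊏_ : Rel (Fin n) 0ℓ
  u ⊏ w = ∃ λ c → (u , c) ∈ₗ arcs × Path arcs c w

  ⊏-isStrictPartialOrder : IsStrictPartialOrder _≡_ _⊏_
  ⊏-isStrictPartialOrder = record
    { isEquivalence = isEquivalence
    ; irrefl        = λ { refl (_ , e , p) → acyclic e p }
    ; trans         = λ { (_ , e , p) (_ , f , q) → _ , e , p ++ᵖ step f q }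
    ; <-resp-≈      = resp₂ _⊏_
    }

  Desc-antisym : ∀ {u w} → Desc N u w → Desc N w u → u ≡ w
  Desc-antisym here       _ = refl
  Desc-antisym (step e p) q = ⊥-elim (acyclic e (p ++ᵖ q))

  reachesLeaf : ∀ x → ∃ λ t → IsLeaf N t × Desc N x t
  reachesLeaf x = go x (spo-noetherian ⊏-isStrictPartialOrder x)
    where
    go : ∀ x → Acc (flip _⊏_) x → ∃ λ t → IsLeaf N t × Desc N x t
    go x (acc below) with outdeg arcs x in o
    ... | zero  = x , o , here
    ... | suc _ with outdeg≡suc⇒∃ o
    ...   | c , e with go c (below (c , e , here))
    ...     | t , leaf , p = t , leaf , step e p

  root-or-parent : ∀ x → x ≡ root ⊎ ∃ λ u → (u , x) ∈ₗ arcs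
  root-or-parent x with vtxDeg x
  ... | inj₁ x≡root                = inj₁ x≡root
  ... | inj₂ (inj₁ (i , _))        = inj₂ (indeg≡suc⇒∃ i)
  ... | inj₂ (inj₂ (inj₁ (i , _))) = inj₂ (indeg≡suc⇒∃ i)
  ... | inj₂ (inj₂ (inj₂ (i , _))) = inj₂ (indeg≡suc⇒∃ i)

  reachableFromRoot : ∀ x → Desc N root x
  reachableFromRoot x = go x (spo-wellFounded ⊏-isStrictPartialOrder x)
    where
    go : ∀ x → Acc _⊏_ x → Desc N root x
    go x (acc above) with root-or-parent x
    ... | inj₁ refl    = here
    ... | inj₂ (u , e) = go u (above (x , e , here)) ++ᵖ step e here

  stableAncestor-above-parent : ∀ {A l a q w} → StableAncestor N A l → a ∈ A →
                                Desc N w a → (q , w) ∈ₗ arcs → ¬ Desc N w l → Desc N l q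
  stableAncestor-above-parent {q = q} sa a∈A w⇝a e w⇝̸l
    with ∈P-++-step⁻ (reachableFromRoot q) e w⇝a (sa _ a∈A (reachableFromRoot q ++ᵖ step e w⇝a))
  ... | inj₁ l⇝q = l⇝q
  ... | inj₂ l∈w⇝a = ⊥-elim (w⇝̸l (∈P⇒prefix l∈w⇝a))

≡2⇒≢1 : ∀ {m} → m ≡ 2 → m ≢ 1
≡2⇒≢1 m≡2 m≡1 = 1+n≢n (trans (sym m≡2) m≡1)

module BelowTreeVertex {n} (N : Network n) {A : Subset n} {l : Fin n}
                       (sa : StableAncestor N A l) {v : Fin n} (tv : IsTreeVertex N v)
                       (l⇝v : Desc N l v) (leaves⊆A : ∀ x → IsLeaf N x → Desc N v x → x ∈ A) where
  open Network N

  Below : Fin n → Set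
  Below = Desc N v

  record Intact (G : MGraph n) : Set where
    field
      below⊆verts   : ∀ {w} → Below w → w ∈ MGraph.verts G
      out-sound     : ∀ {w c} → Below w → (w , c) ∈ₗ MGraph.arcs G → (w , c) ∈ₗ arcs
      out-complete  : ∀ {w c} → Below w → (w , c) ∈ₗ arcs → (w , c) ∈ₗ MGraph.arcs G
      second-parent : ∀ {p w} → Below p → (p , w) ∈ₗ arcs → indeg arcs w ≡ 2 →
                      ∃ λ q → q ≢ p × (q , w) ∈ₗ MGraph.arcs G
  open Intact

  leafInA : ∀ {w} → Below w → ∃ λ a → a ∈ A × Desc N w a
  leafInA v⇝w with reachesLeaf N _
  ... | a , leaf , w⇝a = a , leaves⊆A a leaf (v⇝w ++ᵖ w⇝a) , w⇝a

  parent-below : ∀ {w} → Below w → indeg arcs w ≢ 1 → ∃ λ p → Below p × (p , w) ∈ₗ arcs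
  parent-below v⇝w i≢1 with unsnoc v⇝w
  ... | inj₁ refl = ⊥-elim (i≢1 (proj₁ tv))
  ... | inj₂ parent = parent

  root-not-below : ¬ Below root
  root-not-below v⇝root
    with parent-below v⇝root (λ i → 0≢1+n (trans (sym (proj₁ rootDeg)) i))
  ... | _ , _ , e = indeg≡0⇒∉ (proj₁ rootDeg) e

  not-suppressible : ∀ {G w} → Intact G → Below w →
                     indeg (MGraph.arcs G) w ≡ 1 → outdeg (MGraph.arcs G) w ≡ 1 → ⊥
  not-suppressible {w = w} I v⇝w i o with vtxDeg w
  ... | inj₁ refl = root-not-below v⇝w
  ... | inj₂ (inj₁ (_ , o₀)) =
    let _ , e = outdeg≡suc⇒∃ o in outdeg≡0⇒∉ o₀ (out-sound I v⇝w e)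
  ... | inj₂ (inj₂ (inj₁ (_ , o₂))) =
    let _ , _ , c₁≢c₂ , e₁ , e₂ = outdeg≡2⇒∃₂ simple o₂
    in c₁≢c₂ (outdeg≡1⇒≡ o (out-complete I v⇝w e₁) (out-complete I v⇝w e₂))
  ... | inj₂ (inj₂ (inj₂ (i₂ , _))) =
    let _ , v⇝p , e = parent-below v⇝w (≡2⇒≢1 i₂)
        _ , q≢p , e′ = second-parent I v⇝p e i₂
    in q≢p (indeg≡1⇒≡ i e′ (out-complete I v⇝p e))

  Intact-resp-⊆ : ∀ {V as bs} → as ⊆ bs → bs ⊆ as → Intact (mgraph V as) → Intact (mgraph V bs)
  Intact-resp-⊆ as⊆bs bs⊆as I = record
    { below⊆verts   = below⊆verts I
    ; out-sound     = λ v⇝w e → out-sound I v⇝w (bs⊆as e)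
    ; out-complete  = λ v⇝w e → as⊆bs (out-complete I v⇝w e)
    ; second-parent = λ v⇝p e i₂ → let q , q≢p , e′ = second-parent I v⇝p e i₂ in q , q≢p , as⊆bs e′
    }

  Intact-suppress : ∀ {V as rest} u w′ z → indeg as w′ ≡ 1 → outdeg as w′ ≡ 1 →
                    as ↭ (u , w′) ∷ (w′ , z) ∷ rest →
                    Intact (mgraph V as) → Intact (mgraph (V - w′) ((u , z) ∷ rest))
  Intact-suppress {rest = rest} u w′ z i o π I = record
    { below⊆verts   = λ v⇝w → x∈p∧x≢y⇒x∈p-y (below⊆verts I v⇝w) (≢w′ v⇝w)
    ; out-sound     = out-sound′
    ; out-complete  = out-complete′
    ; second-parent = second-parent′
    }
    where
    w′-not-below : ¬ Below w′
    w′-not-below v⇝w′ = not-suppressible I v⇝w′ i o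

    ≢w′ : ∀ {w} → Below w → w ≢ w′
    ≢w′ v⇝w refl = w′-not-below v⇝w

    u-not-below : ¬ Below u
    u-not-below v⇝u =
      w′-not-below (v⇝u ++ᵖ step (out-sound I v⇝u (∈-resp-↭ (↭-sym π) (here refl))) here)

    out-sound′ : ∀ {w c} → Below w → (w , c) ∈ₗ (u , z) ∷ rest → (w , c) ∈ₗ arcs
    out-sound′ v⇝w (here refl) = ⊥-elim (u-not-below v⇝w)
    out-sound′ v⇝w (there e)   = out-sound I v⇝w (∈-resp-↭ (↭-sym π) (there (there e)))

    out-complete′ : ∀ {w c} → Below w → (w , c) ∈ₗ arcs → (w , c) ∈ₗ (u , z) ∷ rest
    out-complete′ v⇝w e with ∈-resp-↭ π (out-complete I v⇝w e)
    ... | here refl         = ⊥-elim (u-not-below v⇝w)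
    ... | there (here refl) = ⊥-elim (w′-not-below v⇝w)
    ... | there (there e′)  = there e′

    second-parent′ : ∀ {p w} → Below p → (p , w) ∈ₗ arcs → indeg arcs w ≡ 2 →
                     ∃ λ q → q ≢ p × (q , w) ∈ₗ (u , z) ∷ rest
    second-parent′ v⇝p e i₂ with second-parent I v⇝p e i₂
    ... | q , q≢p , e′ with ∈-resp-↭ π e′
    ...   | here refl         = ⊥-elim (w′-not-below (v⇝p ++ᵖ step e here))
    ...   | there (here refl) = u , (λ { refl → u-not-below v⇝p }) , here refl
    ...   | there (there e″)  = q , q≢p , there e″

  Intact-step : ∀ {G H} → SimpStep G H → Intact G → Intact H
  Intact-step (suppress u w′ z _ i o π)   = Intact-suppress u w′ z i o π
  Intact-step (unpar {as = as} {rest} e π) = Intact-resp-⊆ merge split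
    where
    merge : as ⊆ e ∷ rest
    merge f∈as with ∈-resp-↭ π f∈as
    ... | here f≡e         = here f≡e
    ... | there (here f≡e) = here f≡e
    ... | there (there f∈) = there f∈
    split : e ∷ rest ⊆ as
    split (here f≡e) = ∈-resp-↭ (↭-sym π) (here f≡e)
    split (there f∈) = ∈-resp-↭ (↭-sym π) (there (there f∈))

  Intact-steps : ∀ {G H} → Steps G H → Intact G → Intact H
  Intact-steps done        I = I
  Intact-steps (more s ss) I = Intact-steps ss (Intact-step s I)

  pathGraph-intact : ∀ {P} → IsPathGraph N A l P → Intact P
  pathGraph-intact {P} (_ , verts⊇ , _ , arcs⊆ , arcs⊇) = record
    { below⊆verts   = λ v⇝w → let a , a∈A , w⇝a = leafInA v⇝w in verts⊇ _ a a∈A (l⇝v ++ᵖ v⇝w) w⇝a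
    ; out-sound     = λ _ e → proj₁ (arcs⊆ _ _ e)
    ; out-complete  = λ v⇝w e →
        let a , a∈A , c⇝a = leafInA (v⇝w ++ᵖ step e here) in arcs⊇ _ _ a e a∈A (l⇝v ++ᵖ v⇝w) c⇝a
    ; second-parent = λ v⇝p e i₂ →
        let q , q≢p , e′ = indeg≡2⇒other-parent simple i₂ _
        in q , q≢p , in-arc-kept (v⇝p ++ᵖ step e here) i₂ e′
    }
    where
    in-arc-kept : ∀ {q w} → Below w → indeg arcs w ≡ 2 → (q , w) ∈ₗ arcs → (q , w) ∈ₗ MGraph.arcs P
    in-arc-kept {q} {w} v⇝w i₂ e with leafInA v⇝w
    ... | a , a∈A , w⇝a = arcs⊇ q w a e a∈A (stableAncestor-above-parent N sa a∈A w⇝a e w⇝̸l) w⇝a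
      where
      -- w ⇝ l ⇝ v ⇝ w would force w = v, but v is a tree vertex.
      w⇝̸l : ¬ Desc N w l
      w⇝̸l w⇝l = ≡2⇒≢1 i₂ (trans (cong (indeg arcs) (sym (Desc-antisym N v⇝w (w⇝l ++ᵖ l⇝v)))) (proj₁ tv))

lemma2p5 : ∀ {n} (N : Network n) (A : Subset n) → LeafSet N A →
           ∀ (l : Fin n) → IsLSA N A l →
           ∀ (v : Fin n) → IsTreeVertex N v → Desc N l v →
           (∀ x → IsLeaf N x → Desc N v x → x ∈ A) →
           ∀ (P : MGraph n) → IsPathGraph N A l P →
           ∀ (NA : MGraph n) → FullSimplification P NA →
           ∀ (w : Fin n) → Desc N v w → w ∈ MGraph.verts NA
lemma2p5 N _ _ _ lsa _ tv l⇝v leaves⊆A _ pathGraph _ (simplification , _) _ v⇝w =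
  Intact.below⊆verts (Intact-steps simplification (pathGraph-intact pathGraph)) v⇝w
  where open BelowTreeVertex N (proj₁ lsa) tv l⇝v leaves⊆A
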